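{- Let $G=(V,E)$ be an $(\alpha,\beta)$-expander on $n$ vertices with maximum degree $\Delta$. Then: (1) $G$ is an $(\alpha_w,\beta_w)$-wireless expander with $\alpha_w=\alpha$ and $\beta_w\geq\beta/(8\bar\delta)\geq\beta/(8\Delta)$; (2) if $\beta\geq1$, then $\delta_S\le\Delta/\beta$ for every $S$ with $|S|\le\alpha n$, hence $\bar\delta\le\Delta/\beta$ and $\beta_w\geq\beta^2/(8\Delta)$.
   Context: For $S\subseteq V$, $\Gamma(S)$ is its set of neighbors and $\Gamma^-(S)=\Gamma(S)\setminus S$; $G$ is an $(\alpha,\beta)$-expander if $|\Gamma^-(S)|\ge\beta|S|$ whenever $|S|\le\alpha n$. $G$ is an $(\alpha_w,\beta_w)$-wireless expander if for every $S\subseteq V$ with $|S|\le\alpha_w n$ there is $S'\subseteq S$ such that at least $\beta_w|S|$ vertices of $V\setminus S$ are adjacent to exactly one vertex of $S'$. For $S\subseteq V$, $\delta_S=\frac{1}{|\Gamma^-(S)|}\sum_{v\in\Gamma^-(S)}\deg(v,S)$ (with $\deg(v,S)$ the number of neighbors of $v$ in $S$), and $\bar\delta=\max\{\delta_S : S\subseteq V,\ |S|\le\alpha n\}$.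
   Formalization: The expansion parameters α and β are rational numbers. -}

module Defs where

open import Data.Nat as ℕ using (ℕ; zero; suc; _<ᵇ_; _≡ᵇ_)
open import Data.Bool using (Bool; true; false; if_then_else_; _∧_; not)
open import Data.Fin using (Fin)
open import Data.Vec using (Vec; []; _∷_; tabulate; lookup; sum; foldr)
open import Data.List as List using (List)
open import Data.Fin.Subset using (Subset; ∣_∣; _⊆_)
open import Data.Integer using (+_)
open import Data.Rational using (ℚ; 0ℚ; 1ℚ; _/_; _≤_; _<_; _*_; _÷_; _⊔_; NonZero; >-nonZero; positive)
open import Data.Rational.Properties using (_≤?_; _<?_; <-≤-trans; pos*pos⇒pos; positive⁻¹)
open import Data.Product using (Σ; _×_)
open import Relation.Binary.PropositionalEquality using (_≡_)
open import Relation.Nullary.Decidable using (toWitness)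
open import Data.Unit using (tt)

toℚ : ℕ → ℚ
toℚ k = (+ k) / 1

record Graph (n : ℕ) : Set where
  field
    adj    : Fin n → Fin n → Bool
    symm   : ∀ u v → adj u v ≡ adj v u
    irrefl : ∀ v → adj v v ≡ false
open Graph public

countF : ∀ {n} → (Fin n → Bool) → ℕ
countF f = sum (tabulate (λ i → if f i then 1 else 0))

deg : ∀ {n} → Graph n → Fin n → ℕ
deg G v = countF (adj G v)

maxDeg : ∀ {n} → Graph n → ℕ
maxDeg G = foldr _ ℕ._⊔_ 0 (tabulate (deg G))

degIn : ∀ {n} → Graph n → Fin n → Subset n → ℕ
degIn G v S = countF (λ u → lookup S u ∧ adj G v u)

Γ : ∀ {n} → Graph n → Subset n → Subset n
Γ G S = tabulate (λ v → 0 <ᵇ degIn G v S)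

Γ⁻ : ∀ {n} → Graph n → Subset n → Subset n
Γ⁻ G S = tabulate (λ v → lookup (Γ G S) v ∧ not (lookup S v))

Small : ∀ {n} → ℚ → Subset n → Set
Small {n} α S = toℚ ∣ S ∣ ≤ α * toℚ n

Expander : ∀ {n} → Graph n → ℚ → ℚ → Set
Expander {n} G α β = (S : Subset n) → Small α S → β * toℚ ∣ S ∣ ≤ toℚ ∣ Γ⁻ G S ∣

uniqueNbrs : ∀ {n} → Graph n → Subset n → Subset n → ℕ
uniqueNbrs G S S' = countF (λ v → not (lookup S v) ∧ (degIn G v S' ≡ᵇ 1))

WirelessExpander : ∀ {n} → Graph n → ℚ → ℚ → Set
WirelessExpander {n} G αw βw =
  (S : Subset n) → Small αw S →
  Σ (Subset n) (λ S' → S' ⊆ S × βw * toℚ ∣ S ∣ ≤ toℚ (uniqueNbrs G S S'))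

degSum : ∀ {n} → Graph n → Subset n → ℕ
degSum G S = sum (tabulate (λ v → if lookup (Γ⁻ G S) v then degIn G v S else 0))

-- δ_S  (convention: 0 when Γ⁻(S) is empty, where the average is undefined)
δ : ∀ {n} → Graph n → Subset n → ℚ
δ G S with ∣ Γ⁻ G S ∣
... | zero  = 0ℚ
... | suc m = (+ degSum G S) / suc m

allSubsets : (n : ℕ) → List (Subset n)
allSubsets zero    = [] List.∷ List.[]
allSubsets (suc n) = List.map (true ∷_) (allSubsets n) List.++ List.map (false ∷_) (allSubsets n)

-- δ̄ = max { δ_S : |S| ≤ α n }   (max over the empty family taken to be 0; all δ_S ≥ 0)
δ̄ : ∀ {n} → Graph n → ℚ → ℚ
δ̄ {n} G α = List.foldr _⊔_ 0ℚ
  (List.map (δ G) (List.filter (λ S → toℚ ∣ S ∣ ≤? α * toℚ n) (allSubsets n)))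

8ℚ : ℚ
8ℚ = toℚ 8

pos⇒nonZero : ∀ {q} → 0ℚ < q → NonZero q
pos⇒nonZero = >-nonZero

1≤⇒nonZero : ∀ {q} → 1ℚ ≤ q → NonZero q
1≤⇒nonZero h = >-nonZero (<-≤-trans (toWitness {a? = 0ℚ <? 1ℚ} tt) h)


8*pos⇒nonZero : ∀ {q} → 0ℚ < q → NonZero (8ℚ * q)
8*pos⇒nonZero {q} h = >-nonZero (positive⁻¹ (8ℚ * q) ⦃ pos*pos⇒pos 8ℚ q ⦃ positive h ⦄ ⦄)

module Submission where

-- For a set S let N = |Γ⁻(S)| and D = Σ_{v ∈ Γ⁻(S)} deg(v,S), so δ_S = D/N.
-- The core is a purely combinatorial bound (`Neighbourhood.unique-neighbours`):
--     some S′ ⊆ S has U unique neighbours outside S with  N² ≤ 8·D·U.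
-- By Markov's inequality at least N/2 vertices of Γ⁻(S) have degree at most
-- 2D/N into S; a greedy choice of S′ (`UniqueCover`) covers at least N/(4D)
-- times that many of them exactly once, whence N² ≤ 8DU.
-- Any density bound D ≤ b·N then turns β|S| ≤ N into β|S| ≤ 8b·U, i.e.
-- wireless expansion β/(8b) (`Expansion`).  The corollary takes b = δ̄,
-- b = Δ (as D ≤ Δ·N), and, when β ≥ 1, b = Δ/β (as D ≤ Δ|S| ≤ (Δ/β)·N),
-- which also gives δ_S ≤ Δ/β and the ratio β/(8Δ/β) = β²/(8Δ).

open import Defs
open import Data.Bool using (Bool)
open import Data.Fin using (Fin)
open import Data.Rational using (ℚ)
open import Data.Product using (Σ; _×_; _,_; proj₁; proj₂)
open import Data.Fin.Subset using (Subset; ∣_∣; _⊆_)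

-- Finite counting over the vertex set Fin n.
module Counting where
  open import Data.Nat
    using (ℕ; zero; suc; _+_; _*_; _⊔_; _≤_; _<_; _≤ᵇ_; z≤n)
  open import Data.Nat.Properties hiding (_≟_)
  open import Data.Nat.Solver using (module +-*-Solver)
  open import Data.Bool using (Bool; true; false; if_then_else_; _∧_; not; T)
  open import Data.Fin using (Fin; zero; suc; _≟_)
  open import Data.Vec using (lookup; _∷_; [])
  import Data.Vec as Vec
  open import Function using (_∘_)
  open import Relation.Nullary using (does)
  open import Relation.Binary.PropositionalEquality
  open +-*-Solver using (solve; _:+_; _:*_; con; _:=_)

  open import Algebra.Properties.Semiring.Sum +-*-semiring public
    using (sum; sum-cong-≗; ∑-distrib-+; ∑-comm; *-distribˡ-sum; sum-replicate-zero)

  ⟦_⟧ : Bool → ℕ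
  ⟦ b ⟧ = if b then 1 else 0

  when : Bool → ℕ → ℕ
  when b k = if b then k else 0

  sum-tabulate : ∀ {n} (f : Fin n → ℕ) → Vec.sum (Vec.tabulate f) ≡ sum f
  sum-tabulate {zero}  f = refl
  sum-tabulate {suc n} f = cong (f zero +_) (sum-tabulate (f ∘ suc))

  countF-sum : ∀ {n} (f : Fin n → Bool) → countF f ≡ sum (λ i → ⟦ f i ⟧)
  countF-sum f = sum-tabulate (λ i → ⟦ f i ⟧)

  card-sum : ∀ {n} (S : Subset n) → ∣ S ∣ ≡ sum (λ i → ⟦ lookup S i ⟧)
  card-sum []          = refl
  card-sum (true  ∷ S) = cong suc (card-sum S)
  card-sum (false ∷ S) = card-sum S

  sum-mono : ∀ {n} {f g : Fin n → ℕ} → (∀ i → f i ≤ g i) → sum f ≤ sum g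
  sum-mono {zero}  le = z≤n
  sum-mono {suc n} le = +-mono-≤ (le zero) (sum-mono (le ∘ suc))

  sum-mono-< : ∀ {n} {f g : Fin n → ℕ} → (∀ i → f i ≤ g i) → ∀ u → f u < g u → sum f < sum g
  sum-mono-< {suc n} le zero    lt = +-mono-<-≤ lt (sum-mono (le ∘ suc))
  sum-mono-< {suc n} le (suc u) lt = +-mono-≤-< (le zero) (sum-mono-< (le ∘ suc) u lt)

  sum-when : ∀ {n} b (f : Fin n → ℕ) → when b (sum f) ≡ sum (λ i → when b (f i))
  sum-when {n} true  f = refl
  sum-when {n} false f = sym (sum-replicate-zero n)

  sum-point : ∀ {n} (h : Fin n → ℕ) u → sum (λ v → when (does (v ≟ u)) (h v)) ≡ h u
  sum-point {suc n} h zero    = trans (cong (h zero +_) (sum-replicate-zero n)) (+-identityʳ (h zero))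
  sum-point {suc n} h (suc u) = sum-point (h ∘ suc) u

  -- arithmetic core of Markov's inequality below
  halving : ∀ N W light heavy → N ≡ light + heavy → N ≤ W → 2 * W * heavy ≤ N * W → N ≤ 2 * light
  halving N zero    light heavy _  N≤0 _  = ≤-trans N≤0 z≤n
  halving N (suc W) light heavy eq _   hw = +-cancelʳ-≤ N N (2 * light) (begin
    N + N                         ≡⟨ cong₂ _+_ eq eq ⟩
    (light + heavy) + (light + heavy) ≡⟨ solve 2 (λ l h → (l :+ h) :+ (l :+ h) := con 2 :* l :+ con 2 :* h) refl light heavy ⟩
    2 * light + 2 * heavy         ≤⟨ +-monoʳ-≤ (2 * light) 2heavy≤N ⟩
    2 * light + N                 ∎)
    where
    open ≤-Reasoning
    2heavy≤N : 2 * heavy ≤ N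
    2heavy≤N = *-cancelʳ-≤ (2 * heavy) N (suc W)
      (subst (_≤ N * suc W) (solve 2 (λ h w → con 2 :* w :* h := con 2 :* h :* w) refl heavy (suc W)) hw)

  square-bound : ∀ N L D U → N ≤ 2 * L → N * L ≤ 2 * (2 * D * U) → N * N ≤ 8 * (D * U)
  square-bound N L D U N≤2L NL≤ = begin
    N * N                    ≤⟨ *-monoʳ-≤ N N≤2L ⟩
    N * (2 * L)              ≡⟨ solve 2 (λ x l → x :* (con 2 :* l) := con 2 :* (x :* l)) refl N L ⟩
    2 * (N * L)              ≤⟨ *-monoʳ-≤ 2 NL≤ ⟩
    2 * (2 * (2 * D * U))    ≡⟨ solve 2 (λ x u → con 2 :* (con 2 :* (con 2 :* x :* u)) := con 8 :* (x :* u)) refl D U ⟩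
    8 * (D * U)              ∎
    where open ≤-Reasoning

  -- Markov's inequality in counting form: if every vertex of A has weight
  -- at least 1, then, with N = |A| and W the total weight of A, at least
  -- half of A has weight at most twice the average W/N.
  module _ {n} (A : Fin n → Bool) (w : Fin n → ℕ) (A⇒1≤w : ∀ t → A t ≡ true → 1 ≤ w t)
           (N W : ℕ) (N-count : N ≡ sum (λ t → ⟦ A t ⟧)) (W-total : W ≡ sum (λ t → when (A t) (w t))) where
    private
      light heavy : ℕ
      light = sum (λ t → ⟦ A t ∧ (N * w t ≤ᵇ 2 * W) ⟧)
      heavy = sum (λ t → ⟦ A t ∧ not (N * w t ≤ᵇ 2 * W) ⟧)

      N≡light+heavy : N ≡ light + heavy
      N≡light+heavy = trans N-count (trans (sum-cong-≗ λ t → split (A t) (N * w t ≤ᵇ 2 * W)) (∑-distrib-+ {n} _ _))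
        where
        split : ∀ a b → ⟦ a ⟧ ≡ ⟦ a ∧ b ⟧ + ⟦ a ∧ not b ⟧
        split false b     = refl
        split true  true  = refl
        split true  false = refl

      N≤W : N ≤ W
      N≤W = subst₂ _≤_ (sym N-count) (sym W-total) (sum-mono λ t → indicator≤ (A t) (w t) (A⇒1≤w t))
        where
        indicator≤ : ∀ a k → (a ≡ true → 1 ≤ k) → ⟦ a ⟧ ≤ when a k
        indicator≤ true  k h = h refl
        indicator≤ false k h = z≤n

      -- each heavy vertex carries more than 2W/N of the total weight W
      heavy-weight : 2 * W * heavy ≤ N * W
      heavy-weight = begin
        2 * W * heavy                                         ≡⟨ *-distribˡ-sum {n} (2 * W) _ ⟩
        sum (λ t → 2 * W * ⟦ A t ∧ not (N * w t ≤ᵇ 2 * W) ⟧)  ≤⟨ sum-mono bound ⟩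
        sum (λ t → N * when (A t) (w t))                       ≡⟨ *-distribˡ-sum {n} N _ ⟨
        N * sum (λ t → when (A t) (w t))                       ≡⟨ cong (N *_) W-total ⟨
        N * W                                                 ∎
        where
        open ≤-Reasoning
        bound : ∀ t → 2 * W * ⟦ A t ∧ not (N * w t ≤ᵇ 2 * W) ⟧ ≤ N * when (A t) (w t)
        bound t with A t | N * w t ≤ᵇ 2 * W in light?
        ... | false | _     = ≤-reflexive (trans (*-zeroʳ (2 * W)) (sym (*-zeroʳ N)))
        ... | true  | true  = subst (_≤ N * w t) (sym (*-zeroʳ (2 * W))) z≤n
        ... | true  | false = subst (_≤ N * w t) (sym (*-identityʳ (2 * W)))
                                (<⇒≤ (≰⇒> λ le → subst T light? (≤⇒≤ᵇ le)))

    markov : N ≤ 2 * light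
    markov = halving N W light heavy N≡light+heavy N≤W heavy-weight

  ≤-maximum : ∀ {n} (h : Fin n → ℕ) i → h i ≤ Vec.foldr _ _⊔_ 0 (Vec.tabulate h)
  ≤-maximum h zero    = m≤m⊔n (h zero) _
  ≤-maximum h (suc i) = ≤-trans (≤-maximum (h ∘ suc) i) (m≤n⊔m (h zero) _)

-- Given candidate vertices `cand` and target
-- vertices P, grow F ⊆ cand one vertex at a time, adding u whenever it
-- would newly cover more than twice as many targets as it spoils
-- (gain > 2·loss).  Every step keeps "multiply covered ≤ uniquely covered"
-- targets; at a stable F the targets not covered at all are paid for by
-- the uniquely covered ones, so a constant fraction of P is covered
-- exactly once.
module UniqueCover {n} (G : Graph n) (cand P : Fin n → Bool) where
  open Counting
  open import Data.Nat
    using (ℕ; zero; suc; _+_; _*_; _≤_; _<_; _<?_; _≡ᵇ_; _<ᵇ_; z≤n; s≤s)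
  open import Data.Nat.Properties hiding (_≟_)
  open import Data.Nat.Solver using (module +-*-Solver)
  open import Data.Bool using (Bool; true; false; _∧_; _∨_; not)
  import Data.Bool.Properties as Bool
  open import Data.Fin using (Fin; _≟_)
  open import Data.Fin.Properties using (any?)
  open import Relation.Nullary using (does; yes; no)
  open import Relation.Nullary.Decidable using (_×-dec_; dec-true)
  open import Relation.Nullary.Negation using (contradiction)
  open import Relation.Binary.PropositionalEquality
  open +-*-Solver using (solve; _:+_; _:*_; con; _:=_)

  hits : (Fin n → Bool) → Fin n → ℕ
  hits F t = sum λ u → ⟦ F u ∧ adj G t u ⟧

  free : (Fin n → Bool) → Fin n → Bool
  free F u = cand u ∧ not (F u)

  uniq multi : (Fin n → Bool) → ℕ
  uniq F  = sum λ t → ⟦ P t ∧ (hits F t ≡ᵇ 1) ⟧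
  multi F = sum λ t → ⟦ P t ∧ (1 <ᵇ hits F t) ⟧

  gain loss : (Fin n → Bool) → Fin n → ℕ
  gain F u = sum λ t → ⟦ (P t ∧ (hits F t ≡ᵇ 0)) ∧ adj G t u ⟧
  loss F u = sum λ t → ⟦ (P t ∧ (hits F t ≡ᵇ 1)) ∧ adj G t u ⟧

  insert : (Fin n → Bool) → Fin n → Fin n → Bool
  insert F u v = does (v ≟ u) ∨ F v

  hits-insert : ∀ F u → F u ≡ false → ∀ t → hits (insert F u) t ≡ hits F t + ⟦ adj G t u ⟧
  hits-insert F u Fu≡false t = begin
    hits (insert F u) t                                            ≡⟨ sum-cong-≗ split ⟩
    sum (λ v → ⟦ F v ∧ adj G t v ⟧ + when (does (v ≟ u)) ⟦ adj G t v ⟧) ≡⟨ ∑-distrib-+ {n} _ _ ⟩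
    hits F t + sum (λ v → when (does (v ≟ u)) ⟦ adj G t v ⟧)         ≡⟨ cong (hits F t +_) (sum-point _ u) ⟩
    hits F t + ⟦ adj G t u ⟧                                        ∎
    where
    open ≡-Reasoning
    split : ∀ v → ⟦ insert F u v ∧ adj G t v ⟧ ≡ ⟦ F v ∧ adj G t v ⟧ + when (does (v ≟ u)) ⟦ adj G t v ⟧
    split v with v ≟ u
    ... | yes refl rewrite Fu≡false = refl
    ... | no _     = sym (+-identityʳ _)

  -- how one more neighbour in F changes the status of a single target
  more-than-once : ∀ p e x → ⟦ p ∧ (1 <ᵇ x + ⟦ e ⟧) ⟧ ≡ ⟦ p ∧ (1 <ᵇ x) ⟧ + ⟦ (p ∧ (x ≡ᵇ 1)) ∧ e ⟧
  more-than-once false e     x             = refl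
  more-than-once true  false zero          = refl
  more-than-once true  false (suc zero)    = refl
  more-than-once true  false (suc (suc x)) = refl
  more-than-once true  true  zero          = refl
  more-than-once true  true  (suc zero)    = refl
  more-than-once true  true  (suc (suc x)) = refl

  exactly-once : ∀ p e x →
    ⟦ p ∧ (x + ⟦ e ⟧ ≡ᵇ 1) ⟧ + ⟦ (p ∧ (x ≡ᵇ 1)) ∧ e ⟧ ≡ ⟦ p ∧ (x ≡ᵇ 1) ⟧ + ⟦ (p ∧ (x ≡ᵇ 0)) ∧ e ⟧
  exactly-once false e     x             = refl
  exactly-once true  false zero          = refl
  exactly-once true  false (suc zero)    = refl
  exactly-once true  false (suc (suc x)) = refl
  exactly-once true  true  zero          = refl
  exactly-once true  true  (suc zero)    = refl
  exactly-once true  true  (suc (suc x)) = refl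

  multi-insert : ∀ F u → F u ≡ false → multi (insert F u) ≡ multi F + loss F u
  multi-insert F u Fu≡false = trans (sum-cong-≗ step) (∑-distrib-+ {n} _ _)
    where
    step : ∀ t → ⟦ P t ∧ (1 <ᵇ hits (insert F u) t) ⟧ ≡ ⟦ P t ∧ (1 <ᵇ hits F t) ⟧ + ⟦ (P t ∧ (hits F t ≡ᵇ 1)) ∧ adj G t u ⟧
    step t rewrite hits-insert F u Fu≡false t = more-than-once (P t) (adj G t u) (hits F t)

  uniq-insert : ∀ F u → F u ≡ false → uniq (insert F u) + loss F u ≡ uniq F + gain F u
  uniq-insert F u Fu≡false = begin
    uniq (insert F u) + loss F u                                                                     ≡⟨ ∑-distrib-+ {n} _ _ ⟨
    sum (λ t → ⟦ P t ∧ (hits (insert F u) t ≡ᵇ 1) ⟧ + ⟦ (P t ∧ (hits F t ≡ᵇ 1)) ∧ adj G t u ⟧) ≡⟨ sum-cong-≗ step ⟩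
    sum (λ t → ⟦ P t ∧ (hits F t ≡ᵇ 1) ⟧ + ⟦ (P t ∧ (hits F t ≡ᵇ 0)) ∧ adj G t u ⟧)            ≡⟨ ∑-distrib-+ {n} _ _ ⟩
    uniq F + gain F u                                                                                ∎
    where
    open ≡-Reasoning
    step : ∀ t → ⟦ P t ∧ (hits (insert F u) t ≡ᵇ 1) ⟧ + ⟦ (P t ∧ (hits F t ≡ᵇ 1)) ∧ adj G t u ⟧
               ≡ ⟦ P t ∧ (hits F t ≡ᵇ 1) ⟧ + ⟦ (P t ∧ (hits F t ≡ᵇ 0)) ∧ adj G t u ⟧
    step t rewrite hits-insert F u Fu≡false t = exactly-once (P t) (adj G t u) (hits F t)

  -- inserting u with gain > 2·loss keeps "multiply ≤ uniquely covered":
  -- multi grows by loss while uniq grows by gain − loss > loss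
  insert-preserves : ∀ F u → F u ≡ false → multi F ≤ uniq F → 2 * loss F u < gain F u →
                     multi (insert F u) ≤ uniq (insert F u)
  insert-preserves F u Fu≡false inv profitable =
    subst (_≤ uniq (insert F u)) (sym (multi-insert F u Fu≡false)) (+-cancelʳ-≤ ℓ _ _ (begin
      (multi F + ℓ) + ℓ       ≡⟨ solve 2 (λ m l → (m :+ l) :+ l := m :+ con 2 :* l) refl (multi F) ℓ ⟩
      multi F + 2 * ℓ         ≤⟨ +-mono-≤ inv (<⇒≤ profitable) ⟩
      uniq F + gain F u       ≡⟨ uniq-insert F u Fu≡false ⟨
      uniq (insert F u) + ℓ   ∎))
    where
    open ≤-Reasoning
    ℓ : ℕ
    ℓ = loss F u

  remaining : (Fin n → Bool) → ℕ
  remaining F = sum λ u → ⟦ free F u ⟧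

  insert-decreases : ∀ F u → free F u ≡ true → remaining (insert F u) < remaining F
  insert-decreases F u u-free = sum-mono-< shrinks u at-u
    where
    shrinks : ∀ v → ⟦ free (insert F u) v ⟧ ≤ ⟦ free F v ⟧
    shrinks v = fewer (does (v ≟ u)) (cand v) (F v)
      where
      fewer : ∀ x c f → ⟦ c ∧ not (x ∨ f) ⟧ ≤ ⟦ c ∧ not f ⟧
      fewer false c     f = ≤-refl
      fewer true  false f = z≤n
      fewer true  true  f = z≤n
    at-u : ⟦ free (insert F u) u ⟧ < ⟦ free F u ⟧
    at-u rewrite dec-true (u ≟ u) refl | Bool.∧-zeroʳ (cand u) | u-free = s≤s z≤n

  Within : (Fin n → Bool) → Set
  Within F = ∀ u → F u ≡ true → cand u ≡ true

  Stable : (Fin n → Bool) → Set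
  Stable F = ∀ u → free F u ≡ true → gain F u ≤ 2 * loss F u

  free-split : ∀ F u → free F u ≡ true → cand u ≡ true × F u ≡ false
  free-split F u u-free with cand u | F u
  ... | true | false = refl , refl

  insert-within : ∀ F u → free F u ≡ true → Within F → Within (insert F u)
  insert-within F u u-free within v v∈ with v ≟ u
  ... | yes refl = proj₁ (free-split F u u-free)
  ... | no _     = within v v∈

  -- run the greedy procedure; `fuel` bounds the number of remaining steps
  greedy : ∀ fuel F → Within F → multi F ≤ uniq F → remaining F ≤ fuel →
           Σ (Fin n → Bool) λ F′ → Within F′ × multi F′ ≤ uniq F′ × Stable F′
  greedy fuel F within inv bounded
    with any? (λ u → (free F u Bool.≟ true) ×-dec (2 * loss F u <? gain F u))
  ... | no none = F , within , inv , λ u u-free → ≮⇒≥ (λ profitable → none (u , u-free , profitable))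
  ... | yes (u , u-free , profitable) with fuel
  ...   | zero      = contradiction (≤-trans (insert-decreases F u u-free) bounded) λ ()
  ...   | suc fuel′ = greedy fuel′ (insert F u) (insert-within F u u-free within)
                        (insert-preserves F u (proj₂ (free-split F u u-free)) inv profitable)
                        (≤-pred (≤-trans (insert-decreases F u u-free) bounded))

  hits-split : ∀ F → Within F → ∀ t → hits cand t ≡ hits F t + hits (free F) t
  hits-split F within t = trans (sum-cong-≗ λ u → split (cand u) (F u) (adj G t u) (within u)) (∑-distrib-+ {n} _ _)
    where
    split : ∀ c f a → (f ≡ true → c ≡ true) → ⟦ c ∧ a ⟧ ≡ ⟦ f ∧ a ⟧ + ⟦ (c ∧ not f) ∧ a ⟧
    split c     true  a f⇒c rewrite f⇒c refl = sym (+-identityʳ _)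
    split true  false a f⇒c = refl
    split false false a f⇒c = refl

  double-count : ∀ F (Q : Fin n → Bool) →
    sum (λ u → when (free F u) (sum λ t → ⟦ Q t ∧ adj G t u ⟧)) ≡ sum (λ t → when (Q t) (hits (free F) t))
  double-count F Q = begin
    sum (λ u → when (free F u) (sum λ t → ⟦ Q t ∧ adj G t u ⟧))   ≡⟨ sum-cong-≗ (λ u → sum-when {n} (free F u) _) ⟩
    sum (λ u → sum λ t → when (free F u) ⟦ Q t ∧ adj G t u ⟧)     ≡⟨ ∑-comm {n} {n} _ ⟩
    sum (λ t → sum λ u → when (free F u) ⟦ Q t ∧ adj G t u ⟧)     ≡⟨ sum-cong-≗ (λ t → sum-cong-≗ λ u → swap (free F u) (Q t) (adj G t u)) ⟩
    sum (λ t → sum λ u → when (Q t) ⟦ free F u ∧ adj G t u ⟧)     ≡⟨ sum-cong-≗ (λ t → sum-when {n} (Q t) _) ⟨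
    sum (λ t → when (Q t) (hits (free F) t))                       ∎
    where
    open ≡-Reasoning
    swap : ∀ c q a → when c ⟦ q ∧ a ⟧ ≡ when q ⟦ c ∧ a ⟧
    swap true  true  a = refl
    swap true  false a = refl
    swap false true  a = refl
    swap false false a = refl

  module _ (F : Fin n → Bool) (within : Within F) (inv : multi F ≤ uniq F) (stable : Stable F)
           (K L : ℕ) (targets : ∀ t → P t ≡ true → 1 ≤ hits cand t × K * hits cand t ≤ L) where
    private
      none : ℕ
      none = sum λ t → ⟦ P t ∧ (hits F t ≡ᵇ 0) ⟧
      free₀ free₁ : ℕ
      free₀ = sum λ t → when (P t ∧ (hits F t ≡ᵇ 0)) (hits (free F) t)
      free₁ = sum λ t → when (P t ∧ (hits F t ≡ᵇ 1)) (hits (free F) t)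

      targets-split : sum (λ t → ⟦ P t ⟧) ≡ none + uniq F + multi F
      targets-split = trans (sum-cong-≗ λ t → by-hits (P t) (hits F t))
                            (trans (∑-distrib-+ {n} _ _) (cong (_+ multi F) (∑-distrib-+ {n} _ _)))
        where
        by-hits : ∀ p x → ⟦ p ⟧ ≡ ⟦ p ∧ (x ≡ᵇ 0) ⟧ + ⟦ p ∧ (x ≡ᵇ 1) ⟧ + ⟦ p ∧ (1 <ᵇ x) ⟧
        by-hits false x             = refl
        by-hits true  zero          = refl
        by-hits true  (suc zero)    = refl
        by-hits true  (suc (suc x)) = refl

      -- an uncovered target has all its (≥ 1) candidate neighbours free
      none≤free₀ : none ≤ free₀
      none≤free₀ = sum-mono {n} covered
        where
        covered : ∀ t → ⟦ P t ∧ (hits F t ≡ᵇ 0) ⟧ ≤ when (P t ∧ (hits F t ≡ᵇ 0)) (hits (free F) t)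
        covered t with P t in Pt | hits F t | hits-split F within t
        ... | false | _     | _  = z≤n
        ... | true  | zero  | eq = subst (1 ≤_) eq (proj₁ (targets t Pt))
        ... | true  | suc _ | _  = z≤n

      -- stability, summed over the free candidates
      free₀≤2free₁ : free₀ ≤ 2 * free₁
      free₀≤2free₁ = begin
        free₀                                          ≡⟨ double-count F _ ⟨
        sum (λ u → when (free F u) (gain F u))         ≤⟨ sum-mono stable-at ⟩
        sum (λ u → 2 * when (free F u) (loss F u))     ≡⟨ *-distribˡ-sum {n} 2 _ ⟨
        2 * sum (λ u → when (free F u) (loss F u))     ≡⟨ cong (2 *_) (double-count F _) ⟩
        2 * free₁                                      ∎
        where
        open ≤-Reasoning
        stable-at : ∀ u → when (free F u) (gain F u) ≤ 2 * when (free F u) (loss F u)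
        stable-at u with free F u in u-free
        ... | true  = stable u u-free
        ... | false = z≤n

      -- a uniquely covered target has one neighbour in F, the rest free
      once-bound : K * free₁ + K * uniq F ≤ L * uniq F
      once-bound = begin
        K * free₁ + K * uniq F                                                  ≡⟨ cong₂ _+_ (*-distribˡ-sum {n} K _) (*-distribˡ-sum {n} K _) ⟩
        sum (λ t → K * when (Q t) (hits (free F) t)) + sum (λ t → K * ⟦ Q t ⟧)  ≡⟨ ∑-distrib-+ {n} _ _ ⟨
        sum (λ t → K * when (Q t) (hits (free F) t) + K * ⟦ Q t ⟧)              ≤⟨ sum-mono {n} bounded ⟩
        sum (λ t → L * ⟦ Q t ⟧)                                                 ≡⟨ *-distribˡ-sum {n} L _ ⟨
        L * uniq F                                                              ∎
        where
        open ≤-Reasoning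
        Q : Fin n → Bool
        Q t = P t ∧ (hits F t ≡ᵇ 1)
        nothing : K * 0 + K * 0 ≤ L * 0
        nothing = ≤-reflexive (trans (cong₂ _+_ (*-zeroʳ K) (*-zeroʳ K)) (sym (*-zeroʳ L)))
        bounded : ∀ t → K * when (Q t) (hits (free F) t) + K * ⟦ Q t ⟧ ≤ L * ⟦ Q t ⟧
        bounded t with P t in Pt | hits F t | hits-split F within t
        ... | false | _             | _  = nothing
        ... | true  | zero          | _  = nothing
        ... | true  | suc (suc _)   | _  = nothing
        ... | true  | suc zero      | eq = begin
          K * hits (free F) t + K * 1   ≡⟨ solve 2 (λ k h → k :* h :+ k :* con 1 := k :* (con 1 :+ h)) refl K (hits (free F) t) ⟩
          K * (1 + hits (free F) t)     ≡⟨ cong (K *_) eq ⟨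
          K * hits cand t               ≤⟨ proj₂ (targets t Pt) ⟩
          L                             ≡⟨ *-identityʳ L ⟨
          L * 1                         ∎

    stable-bound : K * sum (λ t → ⟦ P t ⟧) ≤ 2 * (L * uniq F)
    stable-bound = begin
      K * sum (λ t → ⟦ P t ⟧)              ≡⟨ cong (K *_) targets-split ⟩
      K * (none + uniq F + multi F)        ≤⟨ *-monoʳ-≤ K (+-mono-≤ (+-monoˡ-≤ (uniq F) (≤-trans none≤free₀ free₀≤2free₁)) inv) ⟩
      K * (2 * free₁ + uniq F + uniq F)    ≡⟨ solve 3 (λ k a u → k :* (con 2 :* a :+ u :+ u) := con 2 :* (k :* a :+ k :* u)) refl K free₁ (uniq F) ⟩
      2 * (K * free₁ + K * uniq F)         ≤⟨ *-monoʳ-≤ 2 once-bound ⟩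
      2 * (L * uniq F)                     ∎
      where open ≤-Reasoning

  unique-cover : (K L : ℕ) → (∀ t → P t ≡ true → 1 ≤ hits cand t × K * hits cand t ≤ L) →
                 Σ (Fin n → Bool) λ F → Within F × K * sum (λ t → ⟦ P t ⟧) ≤ 2 * (L * uniq F)
  unique-cover K L targets with greedy (remaining ∅) ∅ (λ _ ()) ∅-invariant ≤-refl
    where
    ∅ : Fin n → Bool
    ∅ _ = false
    ∅-invariant : multi ∅ ≤ uniq ∅
    ∅-invariant = subst (_≤ uniq ∅) (sym no-multiple) z≤n
      where
      no-multiple : multi ∅ ≡ 0
      no-multiple = trans (sum-cong-≗ λ t → trans (cong (λ x → ⟦ P t ∧ (1 <ᵇ x) ⟧) (sum-replicate-zero n))
                                                  (cong ⟦_⟧ (Bool.∧-zeroʳ (P t))))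
                          (sum-replicate-zero n)
  ... | F , within , inv , stable = F , within , stable-bound F within inv stable K L targets

module Neighbourhood {n} (G : Graph n) (S : Subset n) where
  open Counting
  open import Data.Nat
    using (ℕ; suc; _*_; _≤_; _≡ᵇ_; _<ᵇ_; _≤ᵇ_; z≤n; s≤s)
  open import Data.Nat.Properties hiding (_≟_)
  open import Data.Bool using (Bool; true; false; _∧_; not; T)
  open import Data.Unit using (tt)
  open import Data.Vec using (lookup; tabulate)
  open import Data.Vec.Properties using (lookup∘tabulate; []=⇒lookup; lookup⇒[]=)
  open import Relation.Binary.PropositionalEquality

  inS out : Fin n → Bool
  inS = lookup S
  out = lookup (Γ⁻ G S)

  d : Fin n → ℕ
  d t = degIn G t S

  N D Δ : ℕ
  N = ∣ Γ⁻ G S ∣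
  D = degSum G S
  Δ = maxDeg G

  P : Fin n → Bool
  P t = out t ∧ (N * d t ≤ᵇ 2 * D)

  open UniqueCover G inS P

  d-hits : ∀ t → d t ≡ hits inS t
  d-hits t = countF-sum {n} _

  N-count : N ≡ sum (λ t → ⟦ out t ⟧)
  N-count = card-sum (Γ⁻ G S)

  D-total : D ≡ sum (λ t → when (out t) (d t))
  D-total = sum-tabulate {n} _

  out-spec : ∀ t → out t ≡ (0 <ᵇ d t) ∧ not (inS t)
  out-spec t = trans (lookup∘tabulate _ t) (cong (_∧ not (inS t)) (lookup∘tabulate _ t))

  out⇒ : ∀ t → out t ≡ true → 1 ≤ d t × inS t ≡ false
  out⇒ t out-t rewrite out-spec t with d t | inS t
  ... | suc _ | false = s≤s z≤n , refl

  deg≤Δ : ∀ v → deg G v ≤ Δ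
  deg≤Δ = ≤-maximum (deg G)

  when≤ : ∀ b k → k ≤ Δ → when b k ≤ Δ * ⟦ b ⟧
  when≤ true  k k≤Δ = subst (k ≤_) (sym (*-identityʳ Δ)) k≤Δ
  when≤ false k k≤Δ = z≤n

  d≤Δ : ∀ t → d t ≤ Δ
  d≤Δ t = begin
    d t                           ≡⟨ d-hits t ⟩
    hits inS t                    ≤⟨ sum-mono {n} inS-only ⟩
    sum (λ u → ⟦ adj G t u ⟧)     ≡⟨ countF-sum {n} _ ⟨
    deg G t                       ≤⟨ deg≤Δ t ⟩
    Δ                             ∎
    where
    open ≤-Reasoning
    inS-only : ∀ u → ⟦ inS u ∧ adj G t u ⟧ ≤ ⟦ adj G t u ⟧
    inS-only u with inS u
    ... | true  = ≤-refl
    ... | false = z≤n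

  -- every vertex of Γ⁻(S) has at most Δ neighbours in S
  D≤Δ·N : D ≤ Δ * N
  D≤Δ·N = begin
    D                                   ≡⟨ D-total ⟩
    sum (λ t → when (out t) (d t))      ≤⟨ sum-mono {n} (λ t → when≤ (out t) (d t) (d≤Δ t)) ⟩
    sum (λ t → Δ * ⟦ out t ⟧)           ≡⟨ *-distribˡ-sum {n} Δ _ ⟨
    Δ * sum (λ t → ⟦ out t ⟧)           ≡⟨ cong (Δ *_) N-count ⟨
    Δ * N                               ∎
    where open ≤-Reasoning

  -- double counting the edges between S and Γ⁻(S)
  D≤Δ·|S| : D ≤ Δ * ∣ S ∣
  D≤Δ·|S| = begin
    D                                                ≡⟨ D-total ⟩
    sum (λ t → when (out t) (d t))                   ≤⟨ sum-mono {n} (λ t → when-≤ (out t) (d t)) ⟩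
    sum d                                            ≡⟨ sum-cong-≗ d-hits ⟩
    sum (λ t → sum λ u → ⟦ inS u ∧ adj G t u ⟧)      ≡⟨ ∑-comm {n} {n} _ ⟩
    sum (λ u → sum λ t → ⟦ inS u ∧ adj G t u ⟧)      ≡⟨ sum-cong-≗ (λ u → trans (sum-cong-≗ (edge u)) (sym (sum-when {n} (inS u) _))) ⟩
    sum (λ u → when (inS u) (sum λ t → ⟦ adj G u t ⟧)) ≡⟨ sum-cong-≗ (λ u → cong (when (inS u)) (countF-sum {n} _)) ⟨
    sum (λ u → when (inS u) (deg G u))               ≤⟨ sum-mono {n} (λ u → when≤ (inS u) (deg G u) (deg≤Δ u)) ⟩
    sum (λ u → Δ * ⟦ inS u ⟧)                        ≡⟨ *-distribˡ-sum {n} Δ _ ⟨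
    Δ * sum (λ u → ⟦ inS u ⟧)                        ≡⟨ cong (Δ *_) (card-sum S) ⟨
    Δ * ∣ S ∣                                        ∎
    where
    open ≤-Reasoning
    when-≤ : ∀ b k → when b k ≤ k
    when-≤ true  k = ≤-refl
    when-≤ false k = z≤n
    edge : ∀ u t → ⟦ inS u ∧ adj G t u ⟧ ≡ when (inS u) ⟦ adj G u t ⟧
    edge u t rewrite symm G t u with inS u
    ... | true  = refl
    ... | false = refl

  degIn-tabulate : ∀ F v → degIn G v (tabulate F) ≡ hits F v
  degIn-tabulate F v = trans (countF-sum {n} _) (sum-cong-≗ λ u → cong (λ b → ⟦ b ∧ adj G v u ⟧) (lookup∘tabulate F u))

  tabulate-⊆ : ∀ F → Within F → tabulate F ⊆ S
  tabulate-⊆ F within {v} v∈ = lookup⇒[]= v S (within v (trans (sym (lookup∘tabulate F v)) ([]=⇒lookup v∈)))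

  -- targets lie outside S, so uniquely covered targets are unique neighbours
  uniq≤uniqueNbrs : ∀ F → uniq F ≤ uniqueNbrs G S (tabulate F)
  uniq≤uniqueNbrs F = begin
    uniq F                                                   ≤⟨ sum-mono {n} outside ⟩
    sum (λ t → ⟦ not (inS t) ∧ (hits F t ≡ᵇ 1) ⟧)           ≡⟨ sum-cong-≗ (λ t → cong (λ x → ⟦ not (inS t) ∧ (x ≡ᵇ 1) ⟧) (degIn-tabulate F t)) ⟨
    sum (λ t → ⟦ not (inS t) ∧ (degIn G t (tabulate F) ≡ᵇ 1) ⟧) ≡⟨ countF-sum {n} _ ⟨
    uniqueNbrs G S (tabulate F)                              ∎
    where
    open ≤-Reasoning
    outside : ∀ t → ⟦ P t ∧ (hits F t ≡ᵇ 1) ⟧ ≤ ⟦ not (inS t) ∧ (hits F t ≡ᵇ 1) ⟧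
    outside t with out t in out-t
    ... | false = z≤n
    ... | true rewrite proj₂ (out⇒ t out-t) with N * d t ≤ᵇ 2 * D
    ...   | true  = ≤-refl
    ...   | false = z≤n

  low-degree : ∀ t → P t ≡ true → 1 ≤ hits inS t × N * hits inS t ≤ 2 * D
  low-degree t Pt with out t in out-t | N * d t ≤ᵇ 2 * D in low
  ... | true | true = subst (1 ≤_) (d-hits t) (proj₁ (out⇒ t out-t))
                    , subst (λ x → N * x ≤ 2 * D) (d-hits t) (≤ᵇ⇒≤ (N * d t) (2 * D) (subst T (sym low) tt))

  unique-neighbours : Σ (Subset n) λ S′ → S′ ⊆ S × N * N ≤ 8 * (D * uniqueNbrs G S S′)
  unique-neighbours = from-cover (unique-cover N (2 * D) low-degree)
    where
    from-cover : (Σ (Fin n → Bool) λ F → Within F × N * sum (λ t → ⟦ P t ⟧) ≤ 2 * (2 * D * uniq F)) →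
                 Σ (Subset n) λ S′ → S′ ⊆ S × N * N ≤ 8 * (D * uniqueNbrs G S S′)
    from-cover (F , within , cover) = tabulate F , tabulate-⊆ F within ,
      ≤-trans (square-bound N (sum λ t → ⟦ P t ⟧) D (uniq F) (markov out d (λ t o → proj₁ (out⇒ t o)) N D N-count D-total) cover)
              (*-monoʳ-≤ 8 (*-monoʳ-≤ D (uniq≤uniqueNbrs F)))

module RationalFacts where
  open import Data.Nat as ℕ using (suc)
  import Data.Nat.Coprimality as Coprime
  open import Data.Integer as ℤ using (+_; +≤+)
  import Data.Integer.Properties as ℤ
  open import Data.Rational
  open import Data.Rational.Properties
  open import Data.Rational.Solver using (module +-*-Solver)
  open import Relation.Nullary using (yes; no)
  open import Relation.Nullary.Negation using (contradiction)
  open import Relation.Binary.PropositionalEquality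
  open +-*-Solver using (solve; _:*_; _:=_)

  toℚ-mkℚ : ∀ k → toℚ k ≡ mkℚ (+ k) 0 (Coprime.sym (Coprime.1-coprimeTo k))
  toℚ-mkℚ k = normalize-coprime (Coprime.sym (Coprime.1-coprimeTo k))

  toℚ-* : ∀ a b → toℚ (a ℕ.* b) ≡ toℚ a * toℚ b
  toℚ-* a b rewrite toℚ-mkℚ a | toℚ-mkℚ b = /-cong {p₁ = + (a ℕ.* b)} (ℤ.pos-* a b) refl

  toℚ-mono : ∀ {a b} → a ℕ.≤ b → toℚ a ≤ toℚ b
  toℚ-mono {a} {b} a≤b rewrite toℚ-mkℚ a | toℚ-mkℚ b =
    *≤* (subst₂ ℤ._≤_ (sym (ℤ.*-identityʳ (+ a))) (sym (ℤ.*-identityʳ (+ b))) (+≤+ a≤b))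

  toℚ-nonneg : ∀ k → 0ℚ ≤ toℚ k
  toℚ-nonneg k = toℚ-mono {0} {k} ℕ.z≤n

  toℚ-pos : ∀ k → Positive (toℚ (suc k))
  toℚ-pos k = subst Positive (sym (toℚ-mkℚ (suc k))) _

  nonneg* : ∀ {a b} → 0ℚ ≤ a → 0ℚ ≤ b → 0ℚ ≤ a * b
  nonneg* {a} {b} 0≤a 0≤b = nonNegative⁻¹ (a * b) {{nonNeg*nonNeg⇒nonNeg a {{nonNegative 0≤a}} b {{nonNegative 0≤b}}}}

  pos* : ∀ {a b} → 0ℚ < a → 0ℚ < b → 0ℚ < a * b
  pos* {a} {b} 0<a 0<b = positive⁻¹ (a * b) {{pos*pos⇒pos a {{positive 0<a}} b {{positive 0<b}}}}

  ÷-cancel : ∀ x y .{{_ : NonZero y}} → (x ÷ y) * y ≡ x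
  ÷-cancel x y = begin
    (x * 1/ y) * y   ≡⟨ *-assoc x (1/ y) y ⟩
    x * (1/ y * y)   ≡⟨ cong (x *_) (*-inverseˡ y) ⟩
    x * 1ℚ           ≡⟨ *-identityʳ x ⟩
    x                ∎
    where open ≡-Reasoning

  ÷-nonneg : ∀ x y .{{_ : NonZero y}} → 0ℚ ≤ x → 0ℚ < y → 0ℚ ≤ x ÷ y
  ÷-nonneg x y 0≤x 0<y = *-cancelʳ-≤-pos y {{positive 0<y}} (begin
    0ℚ * y      ≡⟨ *-zeroˡ y ⟩
    0ℚ          ≤⟨ 0≤x ⟩
    x           ≡⟨ ÷-cancel x y ⟨
    (x ÷ y) * y ∎)
    where open ≤-Reasoning

  ÷-≤ : ∀ a c .{{_ : NonZero c}} → 0ℚ < c → ∀ s u → a * s ≤ u * c → (a ÷ c) * s ≤ u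
  ÷-≤ a c 0<c s u as≤uc = *-cancelʳ-≤-pos c {{positive 0<c}} (begin
    ((a ÷ c) * s) * c   ≡⟨ solve 3 (λ x s c → (x :* s) :* c := (x :* c) :* s) refl (a ÷ c) s c ⟩
    ((a ÷ c) * c) * s   ≡⟨ cong (_* s) (÷-cancel a c) ⟩
    a * s               ≤⟨ as≤uc ⟩
    u * c               ∎)
    where open ≤-Reasoning

  rescale-≤ : ∀ b x s u e .{{_ : NonZero b}} → 0ℚ ≤ b → b * s ≤ u * (e * (x ÷ b)) → (b * b) * s ≤ u * (e * x)
  rescale-≤ b x s u e 0≤b bs≤ = begin
    (b * b) * s             ≡⟨ *-assoc b b s ⟩
    b * (b * s)             ≤⟨ *-monoˡ-≤-nonNeg b {{nonNegative 0≤b}} bs≤ ⟩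
    b * (u * (e * (x ÷ b))) ≡⟨ solve 4 (λ b u e q → b :* (u :* (e :* q)) := u :* (e :* (q :* b))) refl b u e (x ÷ b) ⟩
    u * (e * ((x ÷ b) * b)) ≡⟨ cong (λ y → u * (e * y)) (÷-cancel x b) ⟩
    u * (e * x)             ∎
    where open ≤-Reasoning

  -- a² ≤ a·c with c ≥ 0 forces a ≤ c (if c < a, then a > 0 and a·c < a²)
  cancel-square : ∀ {a c} → 0ℚ ≤ c → a * a ≤ a * c → a ≤ c
  cancel-square {a} {c} 0≤c a²≤ac with a ≤? c
  ... | yes a≤c = a≤c
  ... | no  a≰c = contradiction (<-≤-trans (*-monoʳ-<-pos a {{positive 0<a}} c<a) a²≤ac) (<-irrefl refl)
    where
    c<a : c < a
    c<a = ≰⇒> a≰c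
    0<a : 0ℚ < a
    0<a = ≤-<-trans 0≤c c<a

  linearise : ∀ {b n d u} → 0ℚ ≤ b → 0ℚ ≤ u → n * n ≤ 8ℚ * (d * u) → d ≤ b * n → n ≤ u * (8ℚ * b)
  linearise {b} {n} {d} {u} 0≤b 0≤u n²≤8du d≤bn = cancel-square (nonneg* 0≤u (nonneg* (toℚ-nonneg 8) 0≤b)) (begin
    n * n                ≤⟨ n²≤8du ⟩
    8ℚ * (d * u)         ≤⟨ *-monoˡ-≤-nonNeg 8ℚ (*-monoʳ-≤-nonNeg u {{nonNegative 0≤u}} d≤bn) ⟩
    8ℚ * ((b * n) * u)   ≡⟨ solve 4 (λ e b n u → e :* ((b :* n) :* u) := n :* (u :* (e :* b))) refl 8ℚ b n u ⟩
    n * (u * (8ℚ * b))   ∎)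
    where open ≤-Reasoning

module Density where
  open RationalFacts
  open import Data.Nat as ℕ using (zero; suc)
  open import Data.Integer as ℤ using (+_)
  import Data.Integer.Properties as ℤ
  import Data.Nat.Properties as ℕ
  open import Data.Bool using (true; false)
  open import Data.Vec using (_∷_; [])
  open import Data.List as List using (List; foldr; map; filter)
  open import Data.List.Membership.Propositional using (_∈_)
  open import Data.List.Membership.Propositional.Properties using (∈-map⁺; ∈-++⁺ˡ; ∈-++⁺ʳ)
  open import Data.List.Relation.Unary.Any using (here; there)
  open import Data.Rational hiding (∣_∣)
  open import Data.Rational.Properties
  import Data.Rational.Unnormalised as ℚᵘ
  import Data.Rational.Unnormalised.Properties as ℚᵘ
  open import Relation.Nullary using (yes; no)
  open import Relation.Nullary.Negation using (contradiction)
  open import Level using (0ℓ)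
  open import Relation.Unary using (Pred; Decidable)
  open import Relation.Binary.PropositionalEquality

  fraction-cancel : ∀ D m → ((+ D) / suc m) * toℚ (suc m) ≡ toℚ D
  fraction-cancel D m = toℚᵘ-injective (ℚᵘ.≃-trans (toℚᵘ-homo-* ((+ D) / suc m) (toℚ (suc m)))
    (ℚᵘ.≃-trans (ℚᵘ.*-cong (toℚᵘ-fromℚᵘ (ℚᵘ.mkℚᵘ (+ D) m)) (toℚᵘ-cong (toℚ-mkℚ (suc m))))
    (ℚᵘ.≃-trans (ℚᵘ.*≡* cross) (ℚᵘ.≃-sym (toℚᵘ-cong (toℚ-mkℚ D))))))
    where
    cross : (+ D ℤ.* + suc m) ℤ.* + 1 ≡ + D ℤ.* + (suc m ℕ.* 1)
    cross = trans (ℤ.*-identityʳ _) (cong (λ z → + D ℤ.* + z) (sym (ℕ.*-identityʳ (suc m))))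

  module _ {n} (G : Graph n) (S : Subset n) where
    δ-ratio : (∣ Γ⁻ G S ∣ ≡ 0 → degSum G S ≡ 0) → δ G S * toℚ ∣ Γ⁻ G S ∣ ≡ toℚ (degSum G S)
    δ-ratio N≡0⇒D≡0 with ∣ Γ⁻ G S ∣ | N≡0⇒D≡0
    ... | zero  | D≡0 = cong toℚ (sym (D≡0 refl))
    ... | suc m | _   = fraction-cancel (degSum G S) m

    δ-≤ : ∀ b → 0ℚ ≤ b → toℚ (degSum G S) ≤ b * toℚ ∣ Γ⁻ G S ∣ → δ G S ≤ b
    δ-≤ b 0≤b D≤bN with ∣ Γ⁻ G S ∣
    ... | zero  = 0≤b
    ... | suc m = *-cancelʳ-≤-pos (toℚ (suc m)) {{toℚ-pos m}}
                    (subst (_≤ b * toℚ (suc m)) (sym (fraction-cancel (degSum G S) m)) D≤bN)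

  module _ {A : Set} {P : Pred A 0ℓ} (P? : Decidable P) (f : A → ℚ) where
    ≤-filtered-max : ∀ L {x} → x ∈ L → P x → f x ≤ foldr _⊔_ 0ℚ (map f (filter P? L))
    ≤-filtered-max (y List.∷ L) (here refl) px with P? y
    ... | yes _  = p≤p⊔q (f y) _
    ... | no ¬py = contradiction px ¬py
    ≤-filtered-max (y List.∷ L) (there x∈L) px with P? y
    ... | yes _ = p≤q⇒p≤r⊔q (f y) (≤-filtered-max L x∈L px)
    ... | no _  = ≤-filtered-max L x∈L px

    filtered-max-≤ : ∀ L b → 0ℚ ≤ b → (∀ x → P x → f x ≤ b) → foldr _⊔_ 0ℚ (map f (filter P? L)) ≤ b
    filtered-max-≤ List.[]      b 0≤b bound = 0≤b
    filtered-max-≤ (y List.∷ L) b 0≤b bound with P? y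
    ... | yes py = ⊔-lub (bound y py) (filtered-max-≤ L b 0≤b bound)
    ... | no _   = filtered-max-≤ L b 0≤b bound

  allSubsets-complete : ∀ {n} (S : Subset n) → S ∈ allSubsets n
  allSubsets-complete []                = here refl
  allSubsets-complete {suc n} (true ∷ S)  = ∈-++⁺ˡ (∈-map⁺ (true ∷_) (allSubsets-complete S))
  allSubsets-complete {suc n} (false ∷ S) = ∈-++⁺ʳ (map (true ∷_) (allSubsets n)) (∈-map⁺ (false ∷_) (allSubsets-complete S))

  module _ {n} (G : Graph n) (α : ℚ) where
    δ≤δ̄ : ∀ S → Small α S → δ G S ≤ δ̄ G α
    δ≤δ̄ S small = ≤-filtered-max (λ S → toℚ ∣ S ∣ ≤? α * toℚ n) (δ G) (allSubsets n) (allSubsets-complete S) small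

    δ̄-≤ : ∀ b → 0ℚ ≤ b → (∀ S → Small α S → δ G S ≤ b) → δ̄ G α ≤ b
    δ̄-≤ b 0≤b bound = filtered-max-≤ (λ S → toℚ ∣ S ∣ ≤? α * toℚ n) (δ G) (allSubsets n) b 0≤b bound

module Expansion {n} (G : Graph n) {α β : ℚ} (expander : Expander G α β) where
  open RationalFacts
  open Density
  import Data.Nat as ℕ
  import Data.Nat.Properties as ℕ
  open import Data.Rational hiding (∣_∣)
  open import Data.Rational.Properties
  open import Relation.Binary.PropositionalEquality

  Δ : ℚ
  Δ = toℚ (maxDeg G)

  Covered : ℚ → ℚ → Subset n → Set
  Covered a c S = Σ (Subset n) λ S′ → S′ ⊆ S × a * toℚ ∣ S ∣ ≤ toℚ (uniqueNbrs G S S′) * c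

  covered : ∀ b → 0ℚ ≤ b → ∀ S → Small α S → toℚ (degSum G S) ≤ b * toℚ ∣ Γ⁻ G S ∣ → Covered β (8ℚ * b) S
  covered b 0≤b S small D≤bN =
    let S′ , S′⊆S , N²≤8DU = Neighbourhood.unique-neighbours G S
    in  S′ , S′⊆S , ≤-trans (expander S small) (linearise 0≤b (toℚ-nonneg (uniqueNbrs G S S′)) (in-ℚ N²≤8DU) D≤bN)
    where
    N D : ℕ.ℕ
    N = ∣ Γ⁻ G S ∣
    D = degSum G S
    in-ℚ : ∀ {U} → N ℕ.* N ℕ.≤ 8 ℕ.* (D ℕ.* U) → toℚ N * toℚ N ≤ 8ℚ * (toℚ D * toℚ U)
    in-ℚ {U} N²≤8DU = begin
      toℚ N * toℚ N              ≡⟨ toℚ-* N N ⟨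
      toℚ (N ℕ.* N)              ≤⟨ toℚ-mono N²≤8DU ⟩
      toℚ (8 ℕ.* (D ℕ.* U))      ≡⟨ toℚ-* 8 (D ℕ.* U) ⟩
      8ℚ * toℚ (D ℕ.* U)         ≡⟨ cong (8ℚ *_) (toℚ-* D U) ⟩
      8ℚ * (toℚ D * toℚ U)       ∎
      where open ≤-Reasoning

  wireless : ∀ a c .{{_ : NonZero c}} → 0ℚ < c → (∀ S → Small α S → Covered a c S) → WirelessExpander G α (a ÷ c)
  wireless a c 0<c cover S small =
    let S′ , S′⊆S , as≤uc = cover S small in S′ , S′⊆S , ÷-≤ a c 0<c (toℚ ∣ S ∣) (toℚ (uniqueNbrs G S S′)) as≤uc

  wireless-from-density : ∀ b (h : 0ℚ < b) → (∀ S → Small α S → toℚ (degSum G S) ≤ b * toℚ ∣ Γ⁻ G S ∣) →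
                          WirelessExpander G α (_÷_ β (8ℚ * b) ⦃ 8*pos⇒nonZero h ⦄)
  wireless-from-density b h density =
    wireless β (8ℚ * b) ⦃ 8*pos⇒nonZero h ⦄ (pos* (positive⁻¹ 8ℚ {{toℚ-pos 7}}) h) λ S small → covered b (<⇒≤ h) S small (density S small)

  density≤Δ : ∀ S → toℚ (degSum G S) ≤ Δ * toℚ ∣ Γ⁻ G S ∣
  density≤Δ S = subst (toℚ (degSum G S) ≤_) (toℚ-* (maxDeg G) ∣ Γ⁻ G S ∣) (toℚ-mono (Neighbourhood.D≤Δ·N G S))

  density≤δ̄ : ∀ S → Small α S → toℚ (degSum G S) ≤ δ̄ G α * toℚ ∣ Γ⁻ G S ∣
  density≤δ̄ S small = subst (_≤ δ̄ G α * toℚ ∣ Γ⁻ G S ∣) (δ-ratio G S N≡0⇒D≡0)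
                        (*-monoʳ-≤-nonNeg (toℚ ∣ Γ⁻ G S ∣) {{nonNegative (toℚ-nonneg ∣ Γ⁻ G S ∣)}} (δ≤δ̄ G α S small))
    where
    N≡0⇒D≡0 : ∣ Γ⁻ G S ∣ ≡ 0 → degSum G S ≡ 0
    N≡0⇒D≡0 N≡0 = ℕ.n≤0⇒n≡0 (ℕ.≤-trans (subst (λ N → degSum G S ℕ.≤ maxDeg G ℕ.* N) N≡0 (Neighbourhood.D≤Δ·N G S))
                                          (ℕ.≤-reflexive (ℕ.*-zeroʳ (maxDeg G))))

  -- For β ≥ 1 the expansion itself bounds the density: D ≤ Δ|S| ≤ (Δ/β)·N.
  module _ (hβ : 1ℚ ≤ β) where
    0<β : 0ℚ < β
    0<β = <-≤-trans (positive⁻¹ 1ℚ) hβ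

    Δ/β : ℚ
    Δ/β = _÷_ Δ β ⦃ 1≤⇒nonZero hβ ⦄

    0≤Δ/β : 0ℚ ≤ Δ/β
    0≤Δ/β = ÷-nonneg Δ β ⦃ 1≤⇒nonZero hβ ⦄ (toℚ-nonneg (maxDeg G)) 0<β

    density≤Δ/β : ∀ S → Small α S → toℚ (degSum G S) ≤ Δ/β * toℚ ∣ Γ⁻ G S ∣
    density≤Δ/β S small = begin
      toℚ (degSum G S)            ≤⟨ toℚ-mono (Neighbourhood.D≤Δ·|S| G S) ⟩
      toℚ (maxDeg G ℕ.* ∣ S ∣)    ≡⟨ toℚ-* (maxDeg G) ∣ S ∣ ⟩
      Δ * s                       ≡⟨ cong (_* s) (÷-cancel Δ β ⦃ 1≤⇒nonZero hβ ⦄) ⟨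
      (Δ/β * β) * s               ≡⟨ *-assoc Δ/β β s ⟩
      Δ/β * (β * s)               ≤⟨ *-monoˡ-≤-nonNeg Δ/β {{nonNegative 0≤Δ/β}} (expander S small) ⟩
      Δ/β * toℚ ∣ Γ⁻ G S ∣        ∎
      where
      open ≤-Reasoning
      s : ℚ
      s = toℚ ∣ S ∣

    δ≤Δ/β : ∀ S → Small α S → δ G S ≤ Δ/β
    δ≤Δ/β S small = δ-≤ G S Δ/β 0≤Δ/β (density≤Δ/β S small)

    -- the covering ratio β/(8·Δ/β) is β²/(8Δ)
    wireless-β² : (h : 0ℚ < Δ) → WirelessExpander G α (_÷_ (β * β) (8ℚ * Δ) ⦃ 8*pos⇒nonZero h ⦄)
    wireless-β² h = wireless (β * β) (8ℚ * Δ) ⦃ 8*pos⇒nonZero h ⦄ (pos* (positive⁻¹ 8ℚ {{toℚ-pos 7}}) h) λ S small →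
      rescale S (covered Δ/β 0≤Δ/β S small (density≤Δ/β S small))
      where
      rescale : ∀ S → Covered β (8ℚ * Δ/β) S → Covered (β * β) (8ℚ * Δ) S
      rescale S (S′ , S′⊆S , βs≤) = S′ , S′⊆S , rescale-≤ β Δ (toℚ ∣ S ∣) (toℚ (uniqueNbrs G S S′)) 8ℚ ⦃ 1≤⇒nonZero hβ ⦄ (<⇒≤ 0<β) βs≤

open import Data.Rational using (0ℚ; 1ℚ; _≤_; _<_; _*_; _÷_)
open RationalFacts using (toℚ-nonneg)
open Density using (δ-≤; δ̄-≤)

corollaryA4 : ∀ {n} (G : Graph n) (α β : ℚ) → Expander G α β →
  -- (1)
  ((h : 0ℚ < δ̄ G α) → WirelessExpander G α (_÷_ β (8ℚ * δ̄ G α) ⦃ 8*pos⇒nonZero h ⦄))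
  × δ̄ G α ≤ toℚ (maxDeg G)
  × ((h : 0ℚ < toℚ (maxDeg G)) → WirelessExpander G α (_÷_ β (8ℚ * toℚ (maxDeg G)) ⦃ 8*pos⇒nonZero h ⦄))
  -- (2)
  × ((hβ : 1ℚ ≤ β) →
      ((S : Subset n) → Small α S → δ G S ≤ _÷_ (toℚ (maxDeg G)) β ⦃ 1≤⇒nonZero hβ ⦄)
      × δ̄ G α ≤ _÷_ (toℚ (maxDeg G)) β ⦃ 1≤⇒nonZero hβ ⦄
      × ((h : 0ℚ < toℚ (maxDeg G)) → WirelessExpander G α (_÷_ (β * β) (8ℚ * toℚ (maxDeg G)) ⦃ 8*pos⇒nonZero h ⦄)))
corollaryA4 G α β expander =
    (λ h → wireless-from-density (δ̄ G α) h density≤δ̄)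
  , δ̄-≤ G α Δ (toℚ-nonneg (maxDeg G)) (λ S _ → δ-≤ G S Δ (toℚ-nonneg (maxDeg G)) (density≤Δ S))
  , (λ h → wireless-from-density Δ h (λ S _ → density≤Δ S))
  , λ hβ → δ≤Δ/β hβ , δ̄-≤ G α (Δ/β hβ) (0≤Δ/β hβ) (δ≤Δ/β hβ) , wireless-β² hβ
  where open Expansion G {α} {β} expander
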